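{- Let $t<k$ be positive integers. If a $(\bar{1},t)$-LA$(N;k,(v_1,\dots,v_k))$ exists, then for every $i\in\{1,\dots,k\}$ and every integer $a$ with $v_i<a\le 2v_i$, a $(\bar{1},t)$-LA$(2N;k,(v_1,\dots,v_{i-1},a,v_{i+1},\dots,v_k))$ exists.
   Context: For positive integers $N,k,t$ with $t<k$ and $v_1,\dots,v_k$, consider $N\times k$ arrays $A=(a_{rj})$ whose $j$-th column has entries from a set $V_j$ with $|V_j|=v_j$. A $t$-way interaction is $T=\{(j,\sigma_j):j\in I\}$ with $I\subseteq\{1,\dots,k\}$, $|I|=t$, $\sigma_j\in V_j$; $\rho(A,T)$ is the set of rows $r$ with $a_{rj}=\sigma_j$ for all $j\in I$, and $\rho(A,\mathcal T)=\bigcup_{T\in\mathcal T}\rho(A,T)$. $A$ is a $(\bar1,t)$-LA$(N;k,(v_1,\dots,v_k))$ if for all sets $\mathcal T_1,\mathcal T_2$ of $t$-way interactions with $|\mathcal T_1|,|\mathcal T_2|\le 1$: $\rho(A,\mathcal T_1)=\rho(A,\mathcal T_2)\iff\mathcal T_1=\mathcal T_2$ (equivalently: every $t$-way interaction occurs in some row and distinct interactions have distinct $\rho$). -}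

module Defs where

open import Data.Nat using (ℕ; zero; suc; _+_; _*_; _≤_; _<_)
open import Data.Fin using (Fin; _≟_)
open import Data.Unit using (⊤)
open import Relation.Nullary using (yes; no)
open import Data.Maybe using (Maybe; just; nothing)
open import Data.Product using (_×_; Σ; ∃; _,_)
open import Data.Empty using (⊥)
open import Data.List using (List; length; filter)
open import Data.List using (allFin)
open import Data.Maybe using (is-just)
open import Data.Bool using (T)
open import Data.Bool.Properties using (T?)
open import Relation.Binary.PropositionalEquality using (_≡_)
open import Function.Bundles using (_⇔_)

Array : (N k : ℕ) → (Fin k → ℕ) → Set
Array N k v = Fin N → (j : Fin k) → Fin (v j)

-- A "partial assignment": column j is either unconstrained (nothing)
-- or fixed to the value σ_j (just σ_j).
PartialAssignment : (k : ℕ) → (Fin k → ℕ) → Set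
PartialAssignment k v = (j : Fin k) → Maybe (Fin (v j))

support-size : ∀ {k v} → PartialAssignment k v → ℕ
support-size {k} τ = length (filter (λ j → T? (is-just (τ j))) (allFin k))

-- A t-way interaction T = {(j, σ_j) : j ∈ I}, |I| = t, encoded by the
-- partial assignment τ with dom τ = I and τ j = just σ_j for j ∈ I.
Interaction : (t k : ℕ) → (Fin k → ℕ) → Set
Interaction t k v = Σ (PartialAssignment k v) λ τ → support-size τ ≡ t

-- Two interactions are equal as sets of pairs iff they agree pointwise.
SameInteraction : ∀ {t k v} → Interaction t k v → Interaction t k v → Set
SameInteraction {k = k} (τ₁ , _) (τ₂ , _) = (j : Fin k) → τ₁ j ≡ τ₂ j

InRow : ∀ {N t k v} → Array N k v → Interaction t k v → Fin N → Set
InRow {k = k} A (τ , _) r = (j : Fin k) (σ : Fin _) → τ j ≡ just σ → A r j ≡ σ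

-- A set 𝒯 of t-way interactions with |𝒯| ≤ 1: either ∅ or a singleton.
AtMostOne : (t k : ℕ) → (Fin k → ℕ) → Set
AtMostOne t k v = Maybe (Interaction t k v)

InRowSet : ∀ {N t k v} → Array N k v → AtMostOne t k v → Fin N → Set
InRowSet A nothing  r = ⊥
InRowSet A (just T) r = InRow A T r

SameSet : ∀ {t k v} → AtMostOne t k v → AtMostOne t k v → Set
SameSet nothing   nothing   = ⊤
SameSet nothing   (just _)  = ⊥
SameSet (just _)  nothing   = ⊥
SameSet (just T₁) (just T₂) = SameInteraction T₁ T₂

SameRows : ∀ {N t k v} → Array N k v → AtMostOne t k v → AtMostOne t k v → Set
SameRows {N} A 𝒯₁ 𝒯₂ = (r : Fin N) → InRowSet A 𝒯₁ r ⇔ InRowSet A 𝒯₂ r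

IsLA1 : (N t k : ℕ) (v : Fin k → ℕ) → Array N k v → Set
IsLA1 N t k v A = (𝒯₁ 𝒯₂ : AtMostOne t k v) → SameRows A 𝒯₁ 𝒯₂ ⇔ SameSet 𝒯₁ 𝒯₂

LA1Exists : (N t k : ℕ) (v : Fin k → ℕ) → Set
LA1Exists N t k v = Σ (Array N k v) (IsLA1 N t k v)

replaceAt : ∀ {k} → (Fin k → ℕ) → Fin k → ℕ → (Fin k → ℕ)
replaceAt {k} v i a j with i ≟ j
... | yes _ = a
... | no _  = v j

-- Stack two copies of A: in the top copy column i keeps its symbols, read in the lower part
-- {0,…,v_i−1} of {0,…,a−1}; in the bottom copy they are shifted to the upper part
-- {a−v_i,…,a−1}. As a ≤ 2v_i the two parts cover {0,…,a−1}. If the column-i value of an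
-- interaction lies in the lower part, the interaction occurs in exactly the top copies of
-- the rows in which its pull-back to A occurs; otherwise it occurs in no top row, and the
-- same holds for the bottom copy with the upper part. Occurrence and separation in the
-- stacked array thus reduce to those in A, and two interactions of different kinds are
-- separated by the top copy, where only one of them occurs.
module Submission where

open import Defs
open import Data.Nat using (ℕ; _*_; _≤_; _<_)
open import Data.Fin using (Fin)

open import Data.Nat using (_+_; _∸_; z≤n; _≤?_; _<?_)
open import Data.Nat.Properties
  using (+-identityʳ; +-monoˡ-<; <⇒≤; ≤-trans; ≤-reflexive; ≮⇒≥; m≤n+m; m+n∸n≡m; m∸n+n≡m;
         m+[n∸m]≡n; m∸[m∸n]≡n; m≤n+o⇒m∸n≤o; ∸-monoˡ-<)
open import Data.Fin using (toℕ; fromℕ<; _≟_; _↑ˡ_; _↑ʳ_)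
open import Data.Fin.Properties using (toℕ-fromℕ<; toℕ-injective; toℕ<n)
open import Data.Vec.Functional using (_++_)
open import Data.Vec.Functional.Properties using (lookup-++ˡ; lookup-++ʳ)
open import Data.Maybe using (Maybe; just; nothing; is-just; _>>=_)
open import Data.Maybe.Properties using (just-injective)
open import Data.Maybe.Relation.Unary.All as All using (All; just; nothing)
open import Data.Product using (∃; _,_; proj₁; _×_)
open import Data.Sum using (_⊎_; inj₁; inj₂)
open import Data.Empty using (⊥-elim)
open import Data.Unit using (tt)
open import Data.Bool using (T)
open import Data.List using (length; allFin)
open import Data.List.Properties using (filter-≐)
open import Function using (_∘_)
open import Function.Bundles using (_⇔_; mk⇔; Equivalence)
open import Function.Properties.Equivalence using () renaming (sym to ⇔-sym; trans to ⇔-trans)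
open import Relation.Nullary using (¬_; Dec; yes; no; contradiction)
open import Relation.Binary.PropositionalEquality
  using (_≡_; _≢_; refl; sym; trans; cong; cong-app; subst)

-- Locating arrays as covering and separating arrays

Covers : ∀ {N} t {k} {v : Fin k → ℕ} → Array N k v → Set
Covers t {k} {v} A = (T : Interaction t k v) → ¬ SameRows A nothing (just T)

Separates : ∀ {N} t {k} {v : Fin k → ℕ} → Array N k v → Set
Separates t {k} {v} A =
  (T₁ T₂ : Interaction t k v) → SameRows A (just T₁) (just T₂) → SameInteraction T₁ T₂

module _ {N t k : ℕ} {v : Fin k → ℕ} where

  sameSet⇒sameRows : ∀ {A : Array N k v} (𝒯₁ 𝒯₂ : AtMostOne t k v) →
                     SameSet 𝒯₁ 𝒯₂ → SameRows A 𝒯₁ 𝒯₂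
  sameSet⇒sameRows nothing   nothing   _    r = mk⇔ (λ ()) (λ ())
  sameSet⇒sameRows (just T₁) (just T₂) same r =
    mk⇔ (λ H j σ eq → H j σ (trans (same j) eq)) (λ H j σ eq → H j σ (trans (sym (same j)) eq))

  isLA1⇒covers : ∀ {A} → IsLA1 N t k v A → Covers t A
  isLA1⇒covers la T = Equivalence.to (la nothing (just T))

  isLA1⇒separates : ∀ {A} → IsLA1 N t k v A → Separates t A
  isLA1⇒separates la T₁ T₂ = Equivalence.to (la (just T₁) (just T₂))

  covers∧separates⇒isLA1 : ∀ {A} → Covers t A → Separates t A → IsLA1 N t k v A
  covers∧separates⇒isLA1 {A} covers separates 𝒯₁ 𝒯₂ =
    mk⇔ (sameRows⇒sameSet 𝒯₁ 𝒯₂) (sameSet⇒sameRows 𝒯₁ 𝒯₂)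
    where
    sameRows⇒sameSet : ∀ 𝒯₁ 𝒯₂ → SameRows A 𝒯₁ 𝒯₂ → SameSet 𝒯₁ 𝒯₂
    sameRows⇒sameSet nothing   nothing   _    = tt
    sameRows⇒sameSet nothing   (just T)  same = covers T same
    sameRows⇒sameSet (just T)  nothing   same = covers T (λ r → ⇔-sym (same r))
    sameRows⇒sameSet (just T₁) (just T₂) same = separates T₁ T₂ same

inRowSet-≡ : ∀ {M N t k} {v : Fin k → ℕ} {A : Array M k v} {A′ : Array N k v} {r r′}
             (𝒯 : AtMostOne t k v) → A r ≡ A′ r′ → InRowSet A 𝒯 r → InRowSet A′ 𝒯 r′
inRowSet-≡ (just T) eq H j σ τj≡σ = trans (cong-app (sym eq) j) (H j σ τj≡σ)

module _ {M N t k : ℕ} {v : Fin k → ℕ} {A : Array M k v} {A′ : Array N k v} where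

  sameRows-restrict : ∀ {𝒯₁ 𝒯₂ : AtMostOne t k v} (f : Fin N → Fin M) →
                      (∀ r → A (f r) ≡ A′ r) → SameRows A 𝒯₁ 𝒯₂ → SameRows A′ 𝒯₁ 𝒯₂
  sameRows-restrict {𝒯₁} {𝒯₂} f rows same r = mk⇔
    (inRowSet-≡ 𝒯₂ (rows r) ∘ Equivalence.to (same (f r)) ∘ inRowSet-≡ 𝒯₁ (sym (rows r)))
    (inRowSet-≡ 𝒯₁ (rows r) ∘ Equivalence.from (same (f r)) ∘ inRowSet-≡ 𝒯₂ (sym (rows r)))

record DecEmbedding (A B : Set) : Set where
  field
    to      : A → B
    from    : B → Maybe A
    from-to : ∀ x → from (to x) ≡ just x
    to-from : ∀ {w x} → from w ≡ just x → to x ≡ w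

  to-injective : ∀ {x y} → to x ≡ to y → x ≡ y
  to-injective {x} {y} eq = just-injective (trans (sym (from-to x)) (trans (cong from eq) (from-to y)))

open DecEmbedding

idEmbedding : ∀ {A} → DecEmbedding A A
idEmbedding = record
  { to = λ x → x ; from = just ; from-to = λ _ → refl ; to-from = λ { refl → refl } }

_∈Im_ : ∀ {A B} → B → DecEmbedding A B → Set
w ∈Im f = ∃ λ x → from f w ≡ just x

_∈Im?_ : ∀ {A B} (w : B) (f : DecEmbedding A B) → Dec (w ∈Im f)
w ∈Im? f with from f w
... | just x  = yes (x , refl)
... | nothing = no λ { (_ , ()) }

module _ {A B : Set} (f : DecEmbedding A B) where

  is-just-bind-from : ∀ {m} → All (_∈Im f) m → is-just (m >>= from f) ≡ is-just m
  is-just-bind-from nothing             = refl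
  is-just-bind-from (just (_ , from≡x)) rewrite from≡x = refl

  bind-from-injective : ∀ {m₁ m₂} → All (_∈Im f) m₁ → All (_∈Im f) m₂ →
                        (m₁ >>= from f) ≡ (m₂ >>= from f) → m₁ ≡ m₂
  bind-from-injective nothing           nothing           _  = refl
  bind-from-injective nothing           (just (_ , from≡x)) eq with trans eq from≡x
  ... | ()
  bind-from-injective (just (_ , from≡x)) nothing           eq with trans (sym eq) from≡x
  ... | ()
  bind-from-injective (just _)          (just (_ , from≡x)) eq =
    cong just (trans (sym (to-from f (trans eq from≡x))) (to-from f from≡x))

module _ {A B : Set} (f g : DecEmbedding A B) where

  all-∈Im-dichotomy : (∀ w → w ∈Im f ⊎ w ∈Im g) → ∀ m →
               All (_∈Im f) m ⊎ (¬ All (_∈Im f) m × All (_∈Im g) m)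
  all-∈Im-dichotomy cover m with All.dec (_∈Im? f) m
  all-∈Im-dichotomy cover m        | yes inF = inj₁ inF
  all-∈Im-dichotomy cover nothing  | no ¬inF = contradiction nothing ¬inF
  all-∈Im-dichotomy cover (just w) | no ¬inF with cover w
  ... | inj₁ w∈f = contradiction (just w∈f) ¬inF
  ... | inj₂ w∈g = inj₂ (¬inF , just w∈g)

-- Relabelling the symbols of every column

Relabelling : ∀ {k} → (Fin k → ℕ) → (Fin k → ℕ) → Set
Relabelling {k} v v′ = (j : Fin k) → DecEmbedding (Fin (v j)) (Fin (v′ j))

module _ {k : ℕ} {v v′ : Fin k → ℕ} (ρ : Relabelling v v′) where

  relabel : ∀ {N} → Array N k v → Array N k v′
  relabel A r j = to (ρ j) (A r j)

  Liftable : PartialAssignment k v′ → Set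
  Liftable τ = ∀ j → All (_∈Im ρ j) (τ j)

  lift : PartialAssignment k v′ → PartialAssignment k v
  lift τ j = τ j >>= from (ρ j)

  support-size-lift : ∀ {τ} → Liftable τ → support-size (lift τ) ≡ support-size τ
  support-size-lift {τ} l = cong length (filter-≐ _ _ (lift⊆τ , τ⊆lift) (allFin k))
    where
    lift⊆τ : ∀ {j} → T (is-just (lift τ j)) → T (is-just (τ j))
    lift⊆τ {j} = subst T (is-just-bind-from (ρ j) (l j))
    τ⊆lift : ∀ {j} → T (is-just (τ j)) → T (is-just (lift τ j))
    τ⊆lift {j} = subst T (sym (is-just-bind-from (ρ j) (l j)))

  liftInteraction : ∀ {t} (T : Interaction t k v′) → Liftable (proj₁ T) → Interaction t k v
  liftInteraction (τ , size) l = lift τ , trans (support-size-lift l) size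

  module _ {N t : ℕ} (A : Array N k v) (T : Interaction t k v′) where

    inRow-relabel : (l : Liftable (proj₁ T)) (r : Fin N) →
                    InRow (relabel A) T r ⇔ InRow A (liftInteraction T l) r
    inRow-relabel l r = mk⇔ pull push
      where
      pull : InRow (relabel A) T r → InRow A (liftInteraction T l) r
      pull H j x lift≡x with proj₁ T j in τj≡σ
      ... | just σ = to-injective (ρ j) (trans (H j σ τj≡σ) (sym (to-from (ρ j) lift≡x)))
      push : InRow A (liftInteraction T l) r → InRow (relabel A) T r
      push H j σ τj≡σ with All.drop-just (subst (All (_∈Im ρ j)) τj≡σ (l j))
      ... | x , from≡x = trans (cong (to (ρ j)) (H j x lift≡x)) (to-from (ρ j) from≡x)
        where
        lift≡x : lift (proj₁ T) j ≡ just x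
        lift≡x = trans (cong (_>>= from (ρ j)) τj≡σ) from≡x

    inRow-relabel⇒liftable : ∀ {r} → InRow (relabel A) T r → Liftable (proj₁ T)
    inRow-relabel⇒liftable {r} H j with proj₁ T j in τj≡σ
    ... | nothing = nothing
    ... | just σ  =
      just (A r j , subst (λ w → from (ρ j) w ≡ just (A r j)) (H j σ τj≡σ) (from-to (ρ j) (A r j)))

  module _ {N t : ℕ} (A : Array N k v) where

    relabel-covers : Covers t A → (T : Interaction t k v′) → Liftable (proj₁ T) →
                     ¬ SameRows (relabel A) nothing (just T)
    relabel-covers covers T l noRows =
      covers (liftInteraction T l) (λ r → ⇔-trans (noRows r) (inRow-relabel A T l r))

    relabel-noRows : (T : Interaction t k v′) → ¬ Liftable (proj₁ T) →
                     SameRows (relabel A) nothing (just T)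
    relabel-noRows T ¬l r = mk⇔ (λ ()) (¬l ∘ inRow-relabel⇒liftable A T)

    relabel-separates : Separates t A → (T₁ T₂ : Interaction t k v′) →
                        (l₁ : Liftable (proj₁ T₁)) (l₂ : Liftable (proj₁ T₂)) →
                        SameRows (relabel A) (just T₁) (just T₂) → SameInteraction T₁ T₂
    relabel-separates separates T₁ T₂ l₁ l₂ same j =
      bind-from-injective (ρ j) (l₁ j) (l₂ j)
        (separates (liftInteraction T₁ l₁) (liftInteraction T₂ l₂) sameLifts j)
      where
      sameLifts : SameRows A (just (liftInteraction T₁ l₁)) (just (liftInteraction T₂ l₂))
      sameLifts r =
        ⇔-trans (⇔-sym (inRow-relabel A T₁ l₁ r)) (⇔-trans (same r) (inRow-relabel A T₂ l₂ r))

-- Stacking two relabelled copies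

Complementary : ∀ {k} {v v′ : Fin k → ℕ} → Relabelling v v′ → Relabelling v v′ → Set
Complementary {k} {v′ = v′} e g =
  (τ : PartialAssignment k v′) → Liftable e τ ⊎ (¬ Liftable e τ × Liftable g τ)

module _ {k : ℕ} {v v′ : Fin k → ℕ} (e g : Relabelling v v′) (complementary : Complementary e g)
         {N t : ℕ} (A : Array N k v) (covers : Covers t A) where

  private
    upper : (𝒯₁ 𝒯₂ : AtMostOne t k v′) →
            SameRows (relabel e A ++ relabel g A) 𝒯₁ 𝒯₂ → SameRows (relabel e A) 𝒯₁ 𝒯₂
    upper 𝒯₁ 𝒯₂ = sameRows-restrict {𝒯₁ = 𝒯₁} {𝒯₂} (_↑ˡ N) (lookup-++ˡ (relabel e A) (relabel g A))

    lower : (𝒯₁ 𝒯₂ : AtMostOne t k v′) →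
            SameRows (relabel e A ++ relabel g A) 𝒯₁ 𝒯₂ → SameRows (relabel g A) 𝒯₁ 𝒯₂
    lower 𝒯₁ 𝒯₂ = sameRows-restrict {𝒯₁ = 𝒯₁} {𝒯₂} (N ↑ʳ_) (lookup-++ʳ (relabel e A) (relabel g A))

  stack-covers : Covers t (relabel e A ++ relabel g A)
  stack-covers T same with complementary (proj₁ T)
  ... | inj₁ l       = relabel-covers e A covers T l (upper nothing (just T) same)
  ... | inj₂ (_ , l) = relabel-covers g A covers T l (lower nothing (just T) same)

  stack-separates : Separates t A → Separates t (relabel e A ++ relabel g A)
  stack-separates separates T₁ T₂ same with complementary (proj₁ T₁) | complementary (proj₁ T₂)
  ... | inj₁ l₁ | inj₁ l₂ =
    relabel-separates e A separates T₁ T₂ l₁ l₂ (upper (just T₁) (just T₂) same)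
  ... | inj₁ l₁ | inj₂ (¬l₂ , _) = ⊥-elim (relabel-covers e A covers T₁ l₁ λ r →
    ⇔-trans (relabel-noRows e A T₂ ¬l₂ r) (⇔-sym (upper (just T₁) (just T₂) same r)))
  ... | inj₂ (¬l₁ , _) | inj₁ l₂ = ⊥-elim (relabel-covers e A covers T₂ l₂ λ r →
    ⇔-trans (relabel-noRows e A T₁ ¬l₁ r) (upper (just T₁) (just T₂) same r))
  ... | inj₂ (_ , l₁) | inj₂ (_ , l₂) =
    relabel-separates g A separates T₁ T₂ l₁ l₂ (lower (just T₁) (just T₂) same)

liftable-at-column : ∀ {k} {v v′ : Fin k → ℕ} (ρ : Relabelling v v′) (i : Fin k) →
                     (∀ j → j ≢ i → ∀ w → w ∈Im ρ j) →
                     ∀ {τ} → All (_∈Im ρ i) (τ i) → Liftable ρ τ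
liftable-at-column ρ i onto {τ} liftableᵢ j with j ≟ i
... | yes refl = liftableᵢ
... | no j≢i   = All.universal (onto j j≢i) (τ j)

onto-off-column⇒complementary :
  ∀ {k} {v v′ : Fin k → ℕ} (e g : Relabelling v v′) (i : Fin k) →
  (∀ j → j ≢ i → ∀ w → w ∈Im e j) → (∀ j → j ≢ i → ∀ w → w ∈Im g j) →
  (∀ w → w ∈Im e i ⊎ w ∈Im g i) → Complementary e g
onto-off-column⇒complementary e g i e-onto g-onto cover τ
  with all-∈Im-dichotomy (e i) (g i) cover (τ i)
... | inj₁ eᵢ          = inj₁ (liftable-at-column e i e-onto eᵢ)
... | inj₂ (¬eᵢ , gᵢ) = inj₂ ((λ l → ¬eᵢ (l i)) , liftable-at-column g i g-onto gᵢ)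

atColumn : ∀ {k} {v : Fin k → ℕ} {a} (i : Fin k) → DecEmbedding (Fin (v i)) (Fin a) →
           Relabelling v (replaceAt v i a)
atColumn i f j with i ≟ j
... | yes refl = f
... | no _     = idEmbedding

module _ {k : ℕ} {v : Fin k → ℕ} {a : ℕ} (i : Fin k) where

  atColumn-onto : (f : DecEmbedding (Fin (v i)) (Fin a)) →
                  ∀ j → j ≢ i → ∀ w → w ∈Im atColumn {v = v} i f j
  atColumn-onto f j j≢i w with i ≟ j
  ... | yes refl = contradiction refl j≢i
  ... | no _     = w , refl

  atColumn-cover : (f g : DecEmbedding (Fin (v i)) (Fin a)) → (∀ w → w ∈Im f ⊎ w ∈Im g) →
                   ∀ j w → w ∈Im atColumn {v = v} i f j ⊎ w ∈Im atColumn {v = v} i g j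
  atColumn-cover f g cover j w with i ≟ j
  ... | yes refl = cover w
  ... | no _     = inj₁ (w , refl)

  atColumn-complementary : (f g : DecEmbedding (Fin (v i)) (Fin a)) → (∀ w → w ∈Im f ⊎ w ∈Im g) →
                           Complementary (atColumn i f) (atColumn i g)
  atColumn-complementary f g cover =
    onto-off-column⇒complementary (atColumn i f) (atColumn i g) i
      (atColumn-onto f) (atColumn-onto g) (atColumn-cover f g cover i)

module _ {n a : ℕ} (d : ℕ) (n+d≤a : n + d ≤ a) where

  private
    shiftTo : Fin n → Fin a
    shiftTo x = fromℕ< (≤-trans (+-monoˡ-< d (toℕ<n x)) n+d≤a)

    shiftFrom : Fin a → Maybe (Fin n)
    shiftFrom w with d ≤? toℕ w | toℕ w ∸ d <? n
    ... | yes _ | yes w∸d<n = just (fromℕ< w∸d<n)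
    ... | _     | _         = nothing

    shiftFrom-inRange : ∀ {w} → d ≤ toℕ w → (w∸d<n : toℕ w ∸ d < n) →
                        shiftFrom w ≡ just (fromℕ< w∸d<n)
    shiftFrom-inRange {w} d≤w w∸d<n with d ≤? toℕ w | toℕ w ∸ d <? n
    ... | yes _   | yes _   = refl
    ... | no d≰w  | _       = contradiction d≤w d≰w
    ... | yes _   | no w∸d≮n = contradiction w∸d<n w∸d≮n

    shiftFrom-shiftTo : ∀ x → shiftFrom (shiftTo x) ≡ just x
    shiftFrom-shiftTo x =
      trans (shiftFrom-inRange d≤y y∸d<n) (cong just (toℕ-injective (trans (toℕ-fromℕ< y∸d<n) y∸d≡x)))
      where
      toℕ-shiftTo : toℕ (shiftTo x) ≡ toℕ x + d
      toℕ-shiftTo = toℕ-fromℕ< _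
      d≤y : d ≤ toℕ (shiftTo x)
      d≤y = subst (d ≤_) (sym toℕ-shiftTo) (m≤n+m d (toℕ x))
      y∸d≡x : toℕ (shiftTo x) ∸ d ≡ toℕ x
      y∸d≡x = trans (cong (_∸ d) toℕ-shiftTo) (m+n∸n≡m (toℕ x) d)
      y∸d<n : toℕ (shiftTo x) ∸ d < n
      y∸d<n = subst (_< n) (sym y∸d≡x) (toℕ<n x)

    shiftTo-shiftFrom : ∀ {w x} → shiftFrom w ≡ just x → shiftTo x ≡ w
    shiftTo-shiftFrom {w} eq with d ≤? toℕ w | toℕ w ∸ d <? n
    shiftTo-shiftFrom {w} refl | yes d≤w | yes w∸d<n = toℕ-injective
      (trans (toℕ-fromℕ< _) (trans (cong (_+ d) (toℕ-fromℕ< w∸d<n)) (m∸n+n≡m d≤w)))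
    shiftTo-shiftFrom ()       | yes _   | no _
    shiftTo-shiftFrom ()       | no _    | _

  shift : DecEmbedding (Fin n) (Fin a)
  shift = record
    { to = shiftTo ; from = shiftFrom ; from-to = shiftFrom-shiftTo ; to-from = shiftTo-shiftFrom }

  shift-image : ∀ {w} → d ≤ toℕ w → toℕ w ∸ d < n → w ∈Im shift
  shift-image d≤w w∸d<n = _ , shiftFrom-inRange d≤w w∸d<n

module _ {n a : ℕ} (n≤a : n ≤ a) where

  private
    n+0≤a : n + 0 ≤ a
    n+0≤a = subst (_≤ a) (sym (+-identityʳ n)) n≤a

    n+[a∸n]≤a : n + (a ∸ n) ≤ a
    n+[a∸n]≤a = ≤-reflexive (m+[n∸m]≡n n≤a)

  lowerHalf : DecEmbedding (Fin n) (Fin a)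
  lowerHalf = shift 0 n+0≤a

  upperHalf : DecEmbedding (Fin n) (Fin a)
  upperHalf = shift (a ∸ n) n+[a∸n]≤a

  halves-cover : a ≤ 2 * n → ∀ w → w ∈Im lowerHalf ⊎ w ∈Im upperHalf
  halves-cover a≤2n w = byPosition (toℕ w <? n)
    where
    byPosition : Dec (toℕ w < n) → w ∈Im lowerHalf ⊎ w ∈Im upperHalf
    byPosition (yes w<n) = inj₁ (shift-image 0 n+0≤a z≤n w<n)
    byPosition (no w≮n)  = inj₂ (shift-image (a ∸ n) n+[a∸n]≤a a∸n≤w
      (subst (toℕ w ∸ (a ∸ n) <_) (m∸[m∸n]≡n n≤a) (∸-monoˡ-< (toℕ<n w) a∸n≤w)))
      where
      a∸n≤w : a ∸ n ≤ toℕ w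
      a∸n≤w = ≤-trans (subst (a ∸ n ≤_) (+-identityʳ n) (m≤n+o⇒m∸n≤o a n a≤2n)) (≮⇒≥ w≮n)

mainTheorem17 : (N t k : ℕ) (v : Fin k → ℕ) → 1 ≤ N → 1 ≤ t → t < k →
    LA1Exists N t k v →
    (i : Fin k) (a : ℕ) → v i < a → a ≤ 2 * v i →
    LA1Exists (2 * N) t k (replaceAt v i a)
mainTheorem17 N t k v _ _ _ (A , la) i a vᵢ<a a≤2vᵢ =
  -- 2 * N unfolds to N + (N + 0)
  subst (λ M → LA1Exists M t k (replaceAt v i a)) (cong (N +_) (sym (+-identityʳ N)))
    ( relabel lower A ++ relabel upper A
    , covers∧separates⇒isLA1 (stack-covers lower upper complementary A covers)
                             (stack-separates lower upper complementary A covers (isLA1⇒separates la)))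
  where
  vᵢ≤a : v i ≤ a
  vᵢ≤a = <⇒≤ vᵢ<a
  lower upper : Relabelling v (replaceAt v i a)
  lower = atColumn i (lowerHalf vᵢ≤a)
  upper = atColumn i (upperHalf vᵢ≤a)
  complementary : Complementary lower upper
  complementary = atColumn-complementary i _ _ (halves-cover vᵢ≤a a≤2vᵢ)
  covers : Covers t A
  covers = isLA1⇒covers la
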